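{- For all $k,n\ge0$, the $k$-twist congruence $\equiv^k$ is a lattice congruence of the (right) weak order on $\mathfrak S_n$.
   Context: The $k$-twist congruence $\equiv^k$ on $\mathfrak S_n$ (permutations as words in one-line notation) is the transitive closure of the rewriting rule $U\,a\,c\,V_1\,b_1\,V_2\,b_2\cdots V_k\,b_k\,W\equiv^k U\,c\,a\,V_1\,b_1\,V_2\,b_2\cdots V_k\,b_k\,W$ whenever $a<b_i<c$ for all $i\in[k]$, where $a,b_1,\dots,b_k,c\in[n]$ and $U,V_1,\dots,V_k,W$ are (possibly empty) words on $[n]$. The weak order on $\mathfrak S_n$: $\tau\le\tau'$ iff every coinversion of $\tau$ (pair $i<j$ with $\tau^{ -1}(i)>\tau^{ -1}(j)$) is a coinversion of $\tau'$; it is a lattice. An equivalence relation $\equiv$ on a lattice $L$ is a lattice congruence if every equivalence class is an interval of $L$ and the maps sending each element to the minimum (resp. maximum) of its class are order preserving; equivalently, $x\equiv x'$ and $y\equiv y'$ imply $x\wedge y\equiv x'\wedge y'$ and $x\vee y\equiv x'\vee y'$. -}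

module Defs where

open import Data.Nat using (ℕ; zero; suc)
open import Data.Fin using (Fin; _<_)
open import Data.List using (List; []; _∷_; _++_; length)
open import Data.List.Relation.Unary.Unique.Propositional using (Unique)
open import Data.Product using (Σ; ∃; _×_; _,_)
open import Relation.Binary.PropositionalEquality using (_≡_)
open import Relation.Binary.Construct.Closure.Equivalence using (EqClosure)

-- Permutations of [n] in one-line notation: words over Fin n (letters 0..n-1,
-- order-isomorphic to [n]) of length n without repetition.
IsPerm : (n : ℕ) → List (Fin n) → Set
IsPerm n w = Unique w × length w ≡ n

-- Between k a c xs : xs has the shape V₁ b₁ V₂ b₂ ⋯ V_k b_k W with a < b_i < c.
data Between {n : ℕ} (a c : Fin n) : ℕ → List (Fin n) → Set where
  done : ∀ xs → Between a c zero xs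
  skip : ∀ {k} x xs → Between a c (suc k) xs → Between a c (suc k) (x ∷ xs)
  take : ∀ {k} b xs → a < b → b < c → Between a c k xs → Between a c (suc k) (b ∷ xs)

TwistStep : (k : ℕ) {n : ℕ} → List (Fin n) → List (Fin n) → Set
TwistStep k {n} w w′ =
  Σ (List (Fin n)) λ U → Σ (Fin n) λ a → Σ (Fin n) λ c → Σ (List (Fin n)) λ R →
    a < c × Between a c k R × w ≡ U ++ (a ∷ c ∷ R) × w′ ≡ U ++ (c ∷ a ∷ R)

TwistCong : (k : ℕ) {n : ℕ} → List (Fin n) → List (Fin n) → Set
TwistCong k = EqClosure (TwistStep k)

Coinv : {n : ℕ} → List (Fin n) → Fin n → Fin n → Set
Coinv {n} w i j = i < j × Σ (List (Fin n)) λ U → Σ (List (Fin n)) λ V → Σ (List (Fin n)) λ W →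
  w ≡ U ++ (j ∷ V ++ (i ∷ W))

-- Right weak order: inclusion of coinversion sets.
WeakLe : {n : ℕ} → List (Fin n) → List (Fin n) → Set
WeakLe w w′ = ∀ i j → Coinv w i j → Coinv w′ i j

IsClassMin : (n : ℕ) → (List (Fin n) → List (Fin n) → Set) → List (Fin n) → List (Fin n) → Set
IsClassMin n _≈_ m x = IsPerm n m × m ≈ x × (∀ z → IsPerm n z → z ≈ x → WeakLe m z)

IsClassMax : (n : ℕ) → (List (Fin n) → List (Fin n) → Set) → List (Fin n) → List (Fin n) → Set
IsClassMax n _≈_ M x = IsPerm n M × M ≈ x × (∀ z → IsPerm n z → z ≈ x → WeakLe z M)

-- An equivalence relation ≈ on 𝔖ₙ (restricted to words that are permutations) is a
-- lattice congruence of the weak order: every class is an interval [m, M] of the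
-- weak order, and the maps to class minima / maxima are order preserving.
IsLatticeCongruence : (n : ℕ) → (List (Fin n) → List (Fin n) → Set) → Set
IsLatticeCongruence n _≈_ =
  (∀ x → IsPerm n x →
     Σ (List (Fin n)) λ m → Σ (List (Fin n)) λ M →
       IsClassMin n _≈_ m x × IsClassMax n _≈_ M x ×
       (∀ z → IsPerm n z → (z ≈ x → WeakLe m z × WeakLe z M)
                          × (WeakLe m z × WeakLe z M → z ≈ x)))
  × (∀ x y mx my → IsPerm n x → IsPerm n y → WeakLe x y →
       IsClassMin n _≈_ mx x → IsClassMin n _≈_ my y → WeakLe mx my)
  × (∀ x y Mx My → IsPerm n x → IsPerm n y → WeakLe x y →
       IsClassMax n _≈_ Mx x → IsClassMax n _≈_ My y → WeakLe Mx My)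

module Submission where

-- The theory is developed once for any strict total order ◁ on the letters (module
-- Oriented): class minima are its ◁ = < instance and class maxima its ◁ = > instance,
-- as reversing the letter order preserves ≡ᵏ and reverses the weak order.  A descent
-- c a (a ◁ c) followed by S with fewer than k letters of S between a and c is rigid:
-- it pins certain letter pairs in inverted order, and these stay inverted in the
-- whole class (pinned-resp-≈).  A permutation whose descents are all rigid is below
-- every word pinning its descents (le-of-pinned), so it is the least element of its
-- class, and untwisting descents reaches one (irreducible-form).  Pinned pairs move up
-- the weak order, so minima are monotone (least-monotone); and a permutation between
-- two members of a class untwists down into it (interval).

open import Data.Nat using (ℕ)
open import Defs

open import Level using (0ℓ)
open import Function using (_∘_; id)
open import Data.Nat using (zero; suc; _+_; _≤_; _<_; z≤n; s≤s; _≤?_)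
open import Data.Nat.Properties
  using (≤-trans; ≤-reflexive; <-irrefl; ≤-<-trans; <-≤-trans; ≰⇒>; +-monoʳ-<;
         m<m+n; n<1+n; m≤n+m; m≤n⇒m≤1+n; ≤-pred; +-commutativeSemigroup; module ≤-Reasoning)
open import Data.Nat.Induction using (<-wellFounded)
open import Induction.WellFounded using (Acc; acc)
open import Algebra.Properties.CommutativeSemigroup +-commutativeSemigroup using (x∙yz≈y∙xz)
open import Data.Fin using (Fin) renaming (_<_ to _<ᶠ_)
open import Data.Fin.Properties using (<-isStrictTotalOrder; _≟_)
open import Data.List using (List; []; _∷_; _++_; [_]; length; filter; allFin)
open import Data.List.Properties using (∷-injectiveʳ; ++-assoc; length-++; length-tabulate;
                                        filter-notAll; filter-accept; filter-reject)
open import Data.List.Membership.Propositional using (_∈_; _∉_; find)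
open import Data.List.Membership.Propositional.Properties
  using (∈-++⁺ˡ; ∈-++⁺ʳ; ∈-++⁻; ∈-∃++; ∈-filter⁺; ∈-filter⁻; ∈-allFin)
import Data.List.Membership.DecPropositional as DecMembership
open import Data.List.Relation.Unary.Any as Any using (Any; here; there; any?)
open import Data.List.Relation.Unary.All as All using (All; []; _∷_)
open import Data.List.Relation.Unary.All.Properties using (¬Any⇒All¬)
open import Data.List.Relation.Unary.AllPairs using (_∷_)
open import Data.List.Relation.Unary.Unique.Propositional using (Unique)
open import Data.List.Relation.Unary.Unique.Propositional.Properties using (filter⁺)
open import Data.List.Relation.Binary.Permutation.Propositional using (_↭_; ↭-swap; ↭-refl; ↭⇒↭ₛ)
open import Data.List.Relation.Binary.Permutation.Propositional.Properties
  using (++⁺ˡ; ↭-length; ∈-resp-↭; shift; filter-↭)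
import Data.List.Relation.Binary.Permutation.Setoid.Properties as SetoidPerm
open import Data.Product using (Σ; ∃; ∃₂; _×_; _,_; proj₁; proj₂)
open import Data.Sum using (_⊎_; inj₁; inj₂)
open import Data.Empty using (⊥-elim)
open import Relation.Nullary using (¬_; Dec; yes; no)
open import Relation.Nullary.Decidable using (_×-dec_; ¬?)
open import Relation.Unary using (Pred; Decidable)
open import Relation.Binary using (Rel; IsStrictTotalOrder; tri<; tri≈; tri>)
import Relation.Binary.Construct.Flip.EqAndOrd as Flip
open import Relation.Binary.PropositionalEquality
  using (_≡_; _≢_; refl; sym; trans; cong; subst; setoid; module ≡-Reasoning)
open import Relation.Binary.Construct.Closure.ReflexiveTransitive using (ε; _◅_; _◅◅_)
open import Relation.Binary.Construct.Closure.Symmetric using (SymClosure; fwd; bwd)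
import Relation.Binary.Construct.Closure.Symmetric as SymClosure
import Relation.Binary.Construct.Closure.Equivalence as EqClosure

private
  variable
    A : Set
    a b c e p q t u v w x y : A
    m m′ M z xs ys U V W T S : List A
    R : A → A → Set

-- Words over an arbitrary alphabet, and the relative order of their letters.

swap↭ : ∀ (U : List A) {p q T} → U ++ p ∷ q ∷ T ↭ U ++ q ∷ p ∷ T
swap↭ U = ++⁺ˡ U (↭-swap _ _ ↭-refl)

unique-resp-↭ : {A : Set} {xs ys : List A} → xs ↭ ys → Unique xs → Unique ys
unique-resp-↭ {A = A} σ = SetoidPerm.Unique-resp-↭ (setoid A) (↭⇒↭ₛ σ)

data Before {A : Set} : List A → A → A → Set where
  first : v ∈ xs → Before (u ∷ xs) u v
  later : Before xs u v → Before (x ∷ xs) u v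

before-∈ˡ : Before xs u v → u ∈ xs
before-∈ˡ (first _) = here refl
before-∈ˡ (later b) = there (before-∈ˡ b)

before-∈ʳ : Before xs u v → v ∈ xs
before-∈ʳ (first v∈) = there v∈
before-∈ʳ (later b) = there (before-∈ʳ b)

before-++ʳ : ∀ U → Before xs u v → Before (U ++ xs) u v
before-++ʳ [] b = b
before-++ʳ (x ∷ U) b = later (before-++ʳ U b)

before-across : ∀ U → u ∈ U → v ∈ xs → Before (U ++ xs) u v
before-across (x ∷ U) (here refl) v∈ = first (∈-++⁺ʳ U v∈)
before-across (x ∷ U) (there u∈) v∈ = later (before-across U u∈ v∈)

before-in : ∀ U V W → Before (U ++ u ∷ V ++ v ∷ W) u v
before-in U V W = before-++ʳ U (first (∈-++⁺ʳ V (here refl)))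

before-split : Before xs u v → ∃ λ U → ∃₂ λ V W → xs ≡ U ++ u ∷ V ++ v ∷ W
before-split (first v∈) with ∈-∃++ v∈
... | V , W , refl = [] , V , W , refl
before-split {xs = x ∷ _} (later b) with before-split b
... | U , V , W , refl = x ∷ U , V , W , refl

before-≡ : xs ≡ ys → Before ys u v → Before xs u v
before-≡ refl b = b

before-asym : Unique xs → Before xs u v → ¬ Before xs v u
before-asym (u∉ ∷ _) (first v∈) (first u∈) = All.lookup u∉ u∈ refl
before-asym (u∉ ∷ _) (first v∈) (later b) = All.lookup u∉ (before-∈ʳ b) refl
before-asym (v∉ ∷ _) (later b) (first u∈) = All.lookup v∉ (before-∈ʳ b) refl
before-asym (_ ∷ uxs) (later b) (later b′) = before-asym uxs b b′

before-irrefl : Unique xs → ¬ Before xs u u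
before-irrefl uxs b = before-asym uxs b b

before-trans : Unique xs → Before xs u v → Before xs v w → Before xs u w
before-trans (u∉ ∷ _) (first v∈) (first w∈) = ⊥-elim (All.lookup u∉ v∈ refl)
before-trans (_ ∷ _) (first v∈) (later b) = first (before-∈ʳ b)
before-trans (v∉ ∷ _) (later b) (first w∈) = ⊥-elim (All.lookup v∉ (before-∈ʳ b) refl)
before-trans (_ ∷ uxs) (later b) (later b′) = later (before-trans uxs b b′)

before-total : u ≢ v → u ∈ xs → v ∈ xs → Before xs u v ⊎ Before xs v u
before-total u≢v (here refl) (here refl) = ⊥-elim (u≢v refl)
before-total u≢v (here refl) (there v∈) = inj₁ (first v∈)
before-total u≢v (there u∈) (here refl) = inj₂ (first u∈)
before-total u≢v (there u∈) (there v∈) with before-total u≢v u∈ v∈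
... | inj₁ b = inj₁ (later b)
... | inj₂ b = inj₂ (later b)

before? : Unique xs → u ≢ v → u ∈ xs → v ∈ xs → Dec (Before xs u v)
before? uxs u≢v u∈ v∈ with before-total u≢v u∈ v∈
... | inj₁ b = yes b
... | inj₂ b = no (before-asym uxs b)

unique-∉-after : ∀ U → Unique (U ++ xs) → u ∈ U → u ∉ xs
unique-∉-after U uxs u∈U u∈xs = before-irrefl uxs (before-across U u∈U u∈xs)

unique-++ʳ : ∀ U → Unique (U ++ xs) → Unique xs
unique-++ʳ [] uxs = uxs
unique-++ʳ (_ ∷ U) (_ ∷ uxs) = unique-++ʳ U uxs

before-swap : ∀ U → Before (U ++ p ∷ q ∷ T) u v → Before (U ++ q ∷ p ∷ T) u v ⊎ (u ≡ p × v ≡ q)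
before-swap [] (first (here refl)) = inj₂ (refl , refl)
before-swap [] (first (there v∈)) = inj₁ (later (first v∈))
before-swap [] (later (first v∈)) = inj₁ (first (there v∈))
before-swap [] (later (later b)) = inj₁ (later (later b))
before-swap (x ∷ U) (first v∈) = inj₁ (first (∈-resp-↭ (swap↭ U) v∈))
before-swap (x ∷ U) (later b) with before-swap U b
... | inj₁ b′ = inj₁ (later b′)
... | inj₂ eqs = inj₂ eqs

Forced : List A → (A → A → Set) → Set
Forced w R = ∀ u v → R u v → Before w u v

forced-swap : ∀ U → ¬ R p q → Forced (U ++ p ∷ q ∷ T) R → Forced (U ++ q ∷ p ∷ T) R
forced-swap U ¬Rpq forced u v r with before-swap U (forced u v r)
... | inj₁ b = b
... | inj₂ (refl , refl) = ⊥-elim (¬Rpq r)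

order-determines-word : Unique xs → Unique ys → (∀ {x} → x ∈ xs → x ∈ ys) → (∀ {y} → y ∈ ys → y ∈ xs) →
  (∀ {u v} → Before xs u v → Before ys u v) → xs ≡ ys
order-determines-word {xs = []} {ys = []} _ _ _ _ _ = refl
order-determines-word {xs = []} {ys = y ∷ _} _ _ _ ys⊆xs _ with ys⊆xs (here refl)
... | ()
order-determines-word {xs = x ∷ _} {ys = []} _ _ xs⊆ys _ _ with xs⊆ys (here refl)
... | ()
order-determines-word {xs = x ∷ xs} {ys = y ∷ ys} (x∉ ∷ uxs) (y∉ ∷ uys) xs⊆ys ys⊆xs same
  with xs⊆ys (here refl) | ys⊆xs (here refl)
... | here refl | _ = cong (x ∷_) (order-determines-word uxs uys tail⊆ tail⊇ tail-same)
  where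
  tail⊆ : ∀ {z} → z ∈ xs → z ∈ ys
  tail⊆ z∈ with xs⊆ys (there z∈)
  ... | here refl = ⊥-elim (All.lookup x∉ z∈ refl)
  ... | there z∈′ = z∈′
  tail⊇ : ∀ {z} → z ∈ ys → z ∈ xs
  tail⊇ z∈ with ys⊆xs (there z∈)
  ... | here refl = ⊥-elim (All.lookup y∉ z∈ refl)
  ... | there z∈′ = z∈′
  tail-same : ∀ {u v} → Before xs u v → Before ys u v
  tail-same b with same (later b)
  ... | first _ = ⊥-elim (All.lookup x∉ (before-∈ˡ b) refl)
  ... | later b′ = b′
... | there x∈ys | here refl = ⊥-elim (All.lookup y∉ x∈ys refl)
... | there x∈ys | there y∈xs = ⊥-elim (before-asym (y∉ ∷ uys) (same (first y∈xs)) (first x∈ys))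

-- Counting letters, and searching for adjacent pairs of letters.

unique⊆⇒length≤ : Unique xs → (∀ {x} → x ∈ xs → x ∈ ys) → length xs ≤ length ys
unique⊆⇒length≤ {xs = []} _ _ = z≤n
unique⊆⇒length≤ {xs = x ∷ xs} {ys = ys} (x∉ ∷ uxs) xs⊆ys with ∈-∃++ (xs⊆ys (here refl))
... | Y₁ , Y₂ , refl = ≤-trans (s≤s (unique⊆⇒length≤ uxs rest⊆)) (≤-reflexive (sym (↭-length (shift x Y₁ Y₂))))
  where
  rest⊆ : ∀ {y} → y ∈ xs → y ∈ Y₁ ++ Y₂
  rest⊆ y∈ with ∈-resp-↭ (shift x Y₁ Y₂) (xs⊆ys (there y∈))
  ... | here refl = ⊥-elim (All.lookup x∉ y∈ refl)
  ... | there y∈′ = y∈′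

count : {P : Pred A 0ℓ} → Decidable P → List A → ℕ
count P? xs = length (filter P? xs)

count-resp-↭ : {P : Pred A 0ℓ} (P? : Decidable P) → xs ↭ ys → count P? xs ≡ count P? ys
count-resp-↭ P? σ = ↭-length (filter-↭ P? σ)

count-mono : {P P′ : Pred A 0ℓ} (P? : Decidable P) (P′? : Decidable P′) → Unique T →
  (∀ {e} → e ∈ T → P e → e ∈ S × P′ e) → count P? T ≤ count P′? S
count-mono P? P′? uT sub = unique⊆⇒length≤ (filter⁺ P? uT) λ e∈ →
  let e∈T , pe = ∈-filter⁻ P? e∈ ; e∈S , p′e = sub e∈T pe in ∈-filter⁺ P′? e∈S p′e

Adjacent : (A → A → List A → Set) → List A → Set
Adjacent {A} R xs = Σ (List A) λ U → Σ A λ x → Σ A λ y → Σ (List A) λ T → xs ≡ U ++ x ∷ y ∷ T × R x y T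

adjacent? : {R : A → A → List A → Set} → (∀ x y T → Dec (R x y T)) → ∀ xs → Dec (Adjacent R xs)
adjacent? R? [] = no λ { ([] , _ , _ , _ , () , _) ; (_ ∷ _ , _ , _ , _ , () , _) }
adjacent? R? (z ∷ []) = no λ { ([] , _ , _ , _ , () , _) ; (_ ∷ [] , _ , _ , _ , () , _)
                              ; (_ ∷ _ ∷ _ , _ , _ , _ , () , _) }
adjacent? R? (z ∷ w ∷ T) with R? z w T | adjacent? R? (w ∷ T)
... | yes r | _ = yes ([] , z , w , T , refl , r)
... | no _ | yes (U , x , y , T′ , e , r) = yes (z ∷ U , x , y , T′ , cong (z ∷_) e , r)
... | no ¬r | no ¬adj = no λ { ([] , _ , _ , _ , refl , r) → ¬r r
                             ; (_ ∷ U , x , y , T′ , e , r) → ¬adj (U , x , y , T′ , ∷-injectiveʳ e , r) }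

boundary : {H L : A → Set} → ∀ v V u → H v → L u → All (λ w → H w ⊎ L w) V →
  Σ (List A) λ P → Σ A λ c → Σ A λ a → Σ (List A) λ Q →
    v ∷ V ++ [ u ] ≡ P ++ c ∷ a ∷ Q × H c × L a × (v ≡ c ⊎ v ∈ P) × (u ≡ a ⊎ u ∈ Q)
boundary v [] u hv lu [] = [] , v , u , [] , refl , hv , lu , inj₁ refl , inj₁ refl
boundary v (w ∷ V) u hv lu (inj₂ lw ∷ _) =
  [] , v , w , V ++ [ u ] , refl , hv , lw , inj₁ refl , inj₂ (∈-++⁺ʳ V (here refl))
boundary v (w ∷ V) u hv lu (inj₁ hw ∷ hls) with boundary w V u hw lu hls
... | P , c , a , Q , e , hc , la , w-pos , u-pos =
  v ∷ P , c , a , Q , cong (v ∷_) e , hc , la , inj₂ (here refl) , u-pos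

module _ {R : A → A → Set} (R? : ∀ x y → Dec (R x y)) where

  pairs : List A → ℕ
  pairs [] = 0
  pairs (x ∷ xs) = count (λ y → R? y x) xs + pairs xs

  pairs-swap : ∀ U {a c} → R a c → ¬ R c a → pairs (U ++ a ∷ c ∷ T) < pairs (U ++ c ∷ a ∷ T)
  pairs-swap {T = T} [] {a} {c} Rac ¬Rca
    rewrite filter-reject (λ y → R? y a) {c} {T} ¬Rca | filter-accept (λ y → R? y c) {a} {T} Rac =
    s≤s (≤-reflexive (x∙yz≈y∙xz (count (λ y → R? y a) T) (count (λ y → R? y c) T) (pairs T)))
  pairs-swap {T = T} (x ∷ U) {a} {c} Rac ¬Rca
    rewrite count-resp-↭ (λ y → R? y x) (swap↭ U {a} {c} {T}) =
    +-monoʳ-< (count (λ y → R? y x) (U ++ c ∷ a ∷ T)) (pairs-swap U Rac ¬Rca)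

split-gap : ∀ (U : List A) {v V₁ w V₂ u W} →
  U ++ v ∷ (V₁ ++ w ∷ V₂) ++ u ∷ W ≡ U ++ v ∷ V₁ ++ w ∷ (V₂ ++ u ∷ W)
split-gap U {v} {V₁} {w} {V₂} {u} {W} = cong (λ X → U ++ v ∷ X) (++-assoc V₁ (w ∷ V₂) (u ∷ W))

length-left : ∀ (V₁ : List A) {w V₂} → length V₁ < length (V₁ ++ w ∷ V₂)
length-left V₁ {w} {V₂} = subst (length V₁ <_) (sym (length-++ V₁)) (m<m+n (length V₁) (s≤s z≤n))

length-right : ∀ (V₁ : List A) {w V₂} → length V₂ < length (V₁ ++ w ∷ V₂)
length-right V₁ {w} {V₂} =
  subst (length V₂ <_) (sym (length-++ V₁)) (<-≤-trans (n<1+n _) (m≤n+m _ (length V₁)))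

regroup : ∀ (U : List A) {v V u W P c a Q} → v ∷ V ++ [ u ] ≡ P ++ c ∷ a ∷ Q →
  U ++ v ∷ V ++ u ∷ W ≡ (U ++ P) ++ c ∷ a ∷ (Q ++ W)
regroup U {v} {V} {u} {W} {P} {c} {a} {Q} e = begin
    U ++ v ∷ V ++ u ∷ W          ≡⟨ cong (λ X → U ++ v ∷ X) (sym (++-assoc V [ u ] W)) ⟩
    U ++ (v ∷ V ++ [ u ]) ++ W   ≡⟨ cong (λ X → U ++ X ++ W) e ⟩
    U ++ (P ++ c ∷ a ∷ Q) ++ W   ≡⟨ cong (U ++_) (++-assoc P (c ∷ a ∷ Q) W) ⟩
    U ++ P ++ c ∷ a ∷ (Q ++ W)   ≡⟨ sym (++-assoc U P _) ⟩
    (U ++ P) ++ c ∷ a ∷ (Q ++ W) ∎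
  where open ≡-Reasoning

-- Permutations of Fin n: they contain every letter; coinversions via Before.

module _ {n : ℕ} where
  open DecMembership (_≟_ {n}) using (_∈?_)

  perm-complete : {w : List (Fin n)} → IsPerm n w → ∀ x → x ∈ w
  perm-complete {w} (uw , len) x with x ∈? w
  ... | yes x∈w = x∈w
  ... | no x∉w = ⊥-elim (<-irrefl refl (begin-strict
      n                          ≡⟨ sym len ⟩
      length w                   ≤⟨ unique⊆⇒length≤ uw w⊆others ⟩
      count ≢x? (allFin n)       <⟨ filter-notAll ≢x? (allFin n) x-excluded ⟩
      length (allFin n)          ≡⟨ length-tabulate id ⟩
      n                          ∎))
    where
    open ≤-Reasoning
    ≢x? : Decidable (_≢ x)
    ≢x? y = ¬? (y ≟ x)
    w⊆others : ∀ {y} → y ∈ w → y ∈ filter ≢x? (allFin n)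
    w⊆others {y} y∈w = ∈-filter⁺ ≢x? (∈-allFin y) λ { refl → x∉w y∈w }
    x-excluded : Any (λ y → ¬ (y ≢ x)) (allFin n)
    x-excluded = Any.map (λ x≡y y≢x → y≢x (sym x≡y)) (∈-allFin x)

  perm-resp-↭ : {w w′ : List (Fin n)} → w ↭ w′ → IsPerm n w → IsPerm n w′
  perm-resp-↭ σ (uw , len) = unique-resp-↭ σ uw , trans (sym (↭-length σ)) len

  coinv⇒before : {w : List (Fin n)} {i j : Fin n} → Coinv w i j → Before w j i
  coinv⇒before (_ , U , V , W , refl) = before-in U V W

  before⇒coinv : {w : List (Fin n)} {i j : Fin n} → i <ᶠ j → Before w j i → Coinv w i j
  before⇒coinv i<j b with before-split b
  ... | U , V , W , e = i<j , U , V , W , e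

-- The k-twist congruence, seen through a strict total order ◁ on the letters.

module Oriented (k : ℕ) {n : ℕ} {_◁_ : Rel (Fin n) 0ℓ} (◁-sto : IsStrictTotalOrder _≡_ _◁_) where

  open IsStrictTotalOrder ◁-sto using (compare; asym; irrefl) renaming (trans to ◁-trans; _<?_ to _◁?_)

  private
    F : Set
    F = Fin n

  _⊴_ : F → F → Set
  a ⊴ b = a ≡ b ⊎ a ◁ b

  ⊴-◁-trans : a ⊴ b → b ◁ c → a ◁ c
  ⊴-◁-trans (inj₁ refl) b◁c = b◁c
  ⊴-◁-trans (inj₂ a◁b) b◁c = ◁-trans a◁b b◁c

  ◁-⊴-trans : a ◁ b → b ⊴ c → a ◁ c
  ◁-⊴-trans a◁b (inj₁ refl) = a◁b
  ◁-⊴-trans a◁b (inj₂ b◁c) = ◁-trans a◁b b◁c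

  ◁⇒≢ : a ◁ b → a ≢ b
  ◁⇒≢ a◁b refl = irrefl refl a◁b

  Inside : F → F → F → Set
  Inside a c e = a ◁ e × e ◁ c

  inside? : ∀ a c → Decidable (Inside a c)
  inside? a c e = (a ◁? e) ×-dec (e ◁? c)

  outside : ¬ Inside u v w → v ⊴ w ⊎ w ⊴ u
  outside {u = u} {v} {w} ¬inside with compare u w | compare w v
  ... | tri< u◁w _ _ | tri< w◁v _ _ = ⊥-elim (¬inside (u◁w , w◁v))
  ... | tri< _ _ _ | tri≈ _ refl _ = inj₁ (inj₁ refl)
  ... | tri< _ _ _ | tri> _ _ v◁w = inj₁ (inj₂ v◁w)
  ... | tri≈ _ refl _ | _ = inj₂ (inj₁ refl)
  ... | tri> _ _ w◁u | _ = inj₂ (inj₂ w◁u)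

  #inside : F → F → List F → ℕ
  #inside a c T = count (inside? a c) T

  -- A pair a ◁ c followed by T is rigid when T has fewer than k letters between them:
  -- then no twist step can exchange a and c.
  Rigid : F → F → List F → Set
  Rigid a c T = #inside a c T < k

  data Twist : List F → List F → Set where
    twist : ∀ U {a c T} → a ◁ c → k ≤ #inside a c T → Twist (U ++ a ∷ c ∷ T) (U ++ c ∷ a ∷ T)

  unique-twist : Twist x y → Unique x → Unique y
  unique-twist (twist U _ _) = unique-resp-↭ (swap↭ U)

  unique-untwist : Twist x y → Unique y → Unique x
  unique-untwist (twist U _ _) = unique-resp-↭ (swap↭ U)

  Coinversion : List F → F → F → Set
  Coinversion w j i = i ◁ j × Before w j i

  Le : List F → List F → Set
  Le x y = Forced y (Coinversion x)

  le-trans : Le x y → Le y z → Le x z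
  le-trans x≤y y≤z j i (i◁j , b) = y≤z j i (i◁j , x≤y j i (i◁j , b))

  le-twist : Twist x y → Le x y
  le-twist (twist U a◁c _) = forced-swap U (λ (c◁a , _) → asym a◁c c◁a) (λ _ _ → proj₂)

  le-antisym : IsPerm n x → IsPerm n y → Le x y → Le y x → x ≡ y
  le-antisym {x = x} {y} px py x≤y y≤x =
    order-determines-word (proj₁ px) (proj₁ py) (λ {z} _ → perm-complete py z) (λ {z} _ → perm-complete px z) same
    where
    same : ∀ {u v} → Before x u v → Before y u v
    same {u} {v} b with compare u v
    ... | tri< u◁v _ _ with before-total (◁⇒≢ u◁v) (perm-complete py u) (perm-complete py v)
    ...   | inj₁ b′ = b′
    ...   | inj₂ b′ = ⊥-elim (before-asym (proj₁ px) b (y≤x v u (u◁v , b′)))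
    same b | tri≈ _ refl _ = ⊥-elim (before-irrefl (proj₁ px) b)
    same b | tri> _ _ v◁u = x≤y _ _ (v◁u , b)

  Low : F → F → List F → F → Set
  Low a c S b = b ≡ a ⊎ (Inside a c b × b ∈ S)

  High : F → F → List F → F → Set
  High a c S t = t ≡ c ⊎ (Inside a c t × t ∉ S)

  low-◁ : Low a c S b → b ◁ e → a ◁ e
  low-◁ (inj₁ refl) b◁e = b◁e
  low-◁ (inj₂ ((a◁b , _) , _)) b◁e = ◁-trans a◁b b◁e

  high-◁ : High a c S t → e ◁ t → e ◁ c
  high-◁ (inj₁ refl) e◁t = e◁t
  high-◁ (inj₂ ((_ , t◁c) , _)) e◁t = ◁-trans e◁t t◁c

  low-∈ : Low a c S b → b ∈ a ∷ S
  low-∈ (inj₁ refl) = here refl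
  low-∈ (inj₂ (_ , b∈S)) = there b∈S

  PinnedPair : F → F → List F → F → F → Set
  PinnedPair a c S t b = High a c S t × Low a c S b × b ◁ t

  Pinned : List F → F → F → List F → Set
  Pinned w a c S = Forced w (PinnedPair a c S)

  pinned-self : IsPerm n m → m ≡ U ++ c ∷ a ∷ T → a ◁ c → Pinned m a c T
  pinned-self {U = U} {c} {a} {T} pm refl a◁c t b (high , low , _) = from-high high
    where
    b∈ : b ∈ a ∷ T
    b∈ = low-∈ low
    from-high : High a c T t → Before (U ++ c ∷ a ∷ T) t b
    from-high (inj₁ refl) = before-++ʳ U (first b∈)
    from-high (inj₂ ((a◁t , t◁c) , t∉T)) with ∈-++⁻ U (perm-complete pm t)
    ... | inj₁ t∈U = before-across U t∈U (there b∈)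
    ... | inj₂ (here refl) = ⊥-elim (irrefl refl t◁c)
    ... | inj₂ (there (here refl)) = ⊥-elim (irrefl refl a◁t)
    ... | inj₂ (there (there t∈T)) = ⊥-elim (t∉T t∈T)

  pinned-mono : Le x y → Pinned x a c S → Pinned y a c S
  pinned-mono x≤y pinned t b pair@(_ , _ , b◁t) = x≤y t b (b◁t , pinned t b pair)

  -- A twist step never breaks a pinned pair: it only creates a descent.
  pinned-twist : Twist x y → Pinned x a c S → Pinned y a c S
  pinned-twist (twist U p◁q _) = forced-swap U λ (_ , _ , q◁p) → asym p◁q q◁p

  -- Undoing a twist step q p ↦ p q keeps the pairs pinned by a rigid descent: if it broke
  -- the pinned pair (q , p), all k letters of T between p and q would be letters of S
  -- between a and c.
  pinned-untwist : Rigid a c S → Unique y → Twist x y → Pinned y a c S → Pinned x a c S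
  pinned-untwist {a = a} {c} {S} rigid uy (twist U {p} {q} {T} p◁q twistable) pinned =
    forced-swap U broken pinned
    where
    open DecMembership (_≟_ {n}) using (_∈?_)
    broken : ¬ PinnedPair a c S q p
    broken (high-q , low-p , _) with unique-++ʳ U uy
    ... | _ ∷ _ ∷ uT = <-irrefl refl (≤-<-trans (≤-trans twistable (count-mono (inside? p q) (inside? a c) uT between)) rigid)
      where
      between : ∀ {e} → e ∈ T → Inside p q e → e ∈ S × Inside a c e
      between {e} e∈T (p◁e , e◁q) with e ∈? S
      ... | yes e∈S = e∈S , inside-ac
        where inside-ac = low-◁ low-p p◁e , high-◁ high-q e◁q
      ... | no e∉S = ⊥-elim (before-asym uy (pinned e p (inj₂ (inside-ac , e∉S) , low-p , p◁e))
                                            (before-++ʳ U (later (first e∈T))))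
        where inside-ac = low-◁ low-p p◁e , high-◁ high-q e◁q

  DescentsPinned : List F → List F → Set
  DescentsPinned m z = ∀ U c a T → m ≡ U ++ c ∷ a ∷ T → a ◁ c → Pinned z a c T

  -- A coinversion v … u of the permutation m whose gap has no letter between u and v is
  -- pinned by a descent of m: the boundary between the letters weakly above v and
  -- those weakly below u is a descent c a with v high and u low.
  pinned-across : IsPerm n m → DescentsPinned m z → m ≡ U ++ v ∷ V ++ u ∷ W → u ◁ v →
    All (λ w → v ⊴ w ⊎ w ⊴ u) V → Before z v u
  pinned-across {m = m} {U = U} {v} {V} {u} {W} pm pinned e u◁v around
    with boundary {H = v ⊴_} {L = _⊴ u} v V u (inj₁ refl) (inj₁ refl) around
  ... | P , c , a , Q , e′ , v⊴c , a⊴u , v-pos , u-pos =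
    pinned (U ++ P) c a (Q ++ W) m≡ a◁c v u (high v⊴c v-pos , low a⊴u u-pos , u◁v)
    where
    m≡ : m ≡ (U ++ P) ++ c ∷ a ∷ (Q ++ W)
    m≡ = trans e (regroup U e′)
    a◁c : a ◁ c
    a◁c = ⊴-◁-trans a⊴u (◁-⊴-trans u◁v v⊴c)
    low : a ⊴ u → u ≡ a ⊎ u ∈ Q → Low a c (Q ++ W) u
    low (inj₁ refl) _ = inj₁ refl
    low (inj₂ a◁u) (inj₁ refl) = ⊥-elim (irrefl refl a◁u)
    low (inj₂ a◁u) (inj₂ u∈Q) = inj₂ ((a◁u , ◁-⊴-trans u◁v v⊴c) , ∈-++⁺ˡ u∈Q)
    high : v ⊴ c → v ≡ c ⊎ v ∈ P → High a c (Q ++ W) v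
    high (inj₁ refl) _ = inj₁ refl
    high (inj₂ v◁c) (inj₁ refl) = ⊥-elim (irrefl refl v◁c)
    high (inj₂ v◁c) (inj₂ v∈P) =
      inj₂ ((⊴-◁-trans a⊴u u◁v , v◁c) ,
            λ v∈ → unique-∉-after (U ++ P) (subst Unique m≡ (proj₁ pm)) (∈-++⁺ʳ U v∈P) (there (there v∈)))

  -- If the descents of the permutation m are pinned in z, then m ≤ z: split the gap of
  -- a coinversion v … u of m at a letter between u and v, by induction on the gap length,
  -- until no such letter is left (pinned-across).
  le-of-pinned : IsPerm n m → Unique z → DescentsPinned m z → Le m z
  le-of-pinned {m = m} {z} pm uz pinned j i (i◁j , b) with before-split b
  ... | U , V , W , e = gap U V W (<-wellFounded (length V)) e i◁j
    where
    gap : ∀ U V W {u v} → Acc _<_ (length V) → m ≡ U ++ v ∷ V ++ u ∷ W → u ◁ v → Before z v u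
    gap U V W {u} {v} (acc shorter) e u◁v with any? (inside? u v) V
    ... | no none = pinned-across pm pinned e u◁v (All.map outside (¬Any⇒All¬ V none))
    ... | yes some with find some
    ...   | w , w∈V , (u◁w , w◁v) with ∈-∃++ w∈V
    ...     | V₁ , V₂ , refl = before-trans uz
      (gap U V₁ (V₂ ++ u ∷ W) (shorter (length-left V₁)) (trans e (split-gap U)) w◁v)
      (gap (U ++ v ∷ V₁) V₂ W (shorter (length-right V₁))
           (trans e (trans (split-gap U) (sym (++-assoc U (v ∷ V₁) _)))) u◁w)

  TwistableDescent : F → F → List F → Set
  TwistableDescent c a T = a ◁ c × k ≤ #inside a c T

  twistableDescent? : ∀ c a T → Dec (TwistableDescent c a T)
  twistableDescent? c a T = (a ◁? c) ×-dec (k ≤? #inside a c T)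

  Irreducible : List F → Set
  Irreducible m = ¬ Adjacent TwistableDescent m

  irreducible-rigid : Irreducible m → m ≡ U ++ c ∷ a ∷ T → a ◁ c → Rigid a c T
  irreducible-rigid irr e a◁c = ≰⇒> λ twistable → irr (_ , _ , _ , _ , e , a◁c , twistable)

  NewDescent : List F → F → F → List F → Set
  NewDescent m c a T = a ◁ c × Before m a c

  -- If m ≤ z and some coinversion v … u of z is not one of m, then z has an adjacent
  -- descent which is not a coinversion of m: scan the gap of v … u from the left.
  new-descent : IsPerm n m → IsPerm n z → Le m z → u ◁ v → Before z v u → Before m u v →
    Adjacent (NewDescent m) z
  new-descent {m = m} {z} pm pz m≤z u◁v bz bm with before-split bz
  ... | U , V , W , e = scan U V W e u◁v bm
    where
    um = proj₁ pm
    uz = proj₁ pz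
    scan : ∀ U V W {u v} → z ≡ U ++ v ∷ V ++ u ∷ W → u ◁ v → Before m u v → Adjacent (NewDescent m) z
    scan U [] W {u} {v} e u◁v bm = U , v , u , W , e , u◁v , bm
    scan U (w ∷ V) W {u} {v} e u◁v bm with compare w v
    ... | tri≈ _ refl _ = ⊥-elim (before-irrefl uz (before-≡ e (before-++ʳ U (first (here refl)))))
    ... | tri< w◁v _ _ with before-total (◁⇒≢ w◁v) (perm-complete pm w) (perm-complete pm v)
    ...   | inj₁ bwv = U , v , w , V ++ u ∷ W , e , w◁v , bwv
    ...   | inj₂ bvw with compare w u
    ...     | tri< w◁u _ _ = ⊥-elim (before-asym uz (before-≡ e zwu) (m≤z u w (w◁u , before-trans um bm bvw)))
      where zwu = before-++ʳ U (later (first (∈-++⁺ʳ V (here refl))))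
    ...     | tri≈ _ refl _ = ⊥-elim (before-irrefl uz (before-≡ e (before-++ʳ U (later (first (∈-++⁺ʳ V (here refl)))))))
    ...     | tri> _ _ u◁w = scan (U ++ [ v ]) V W (trans e (sym (++-assoc U [ v ] _))) u◁w (before-trans um bm bvw)
    scan U (w ∷ V) W {u} {v} e u◁v bm | tri> _ _ v◁w
      with before-total (◁⇒≢ (◁-trans u◁v v◁w)) (perm-complete pm u) (perm-complete pm w)
    ... | inj₁ buw = scan (U ++ [ v ]) V W (trans e (sym (++-assoc U [ v ] _))) (◁-trans u◁v v◁w) buw
    ... | inj₂ bwu = ⊥-elim (before-asym uz (before-≡ e (before-++ʳ U (first (here refl))))
                                          (m≤z w v (v◁w , before-trans um bwu bm)))

  -- From here on, the twist steps of the statement are identified with Twist steps: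
  -- every TwistStep is a Twist in one direction or the other, and conversely.
  module Classes (view : ∀ {x y} → TwistStep k x y → SymClosure Twist x y)
                 (realise : ∀ {x y} → Twist x y → SymClosure (TwistStep k) x y) where

    ≈-sym : TwistCong k x y → TwistCong k y x
    ≈-sym = EqClosure.symmetric (TwistStep k)

    step-view : SymClosure (TwistStep k) x y → SymClosure Twist x y
    step-view (fwd s) = view s
    step-view (bwd s) = SymClosure.symmetric Twist (view s)

    untwist : ∀ U {a c T} → a ◁ c → k ≤ #inside a c T → TwistCong k (U ++ c ∷ a ∷ T) (U ++ a ∷ c ∷ T)
    untwist U a◁c twistable = SymClosure.symmetric (TwistStep k) (realise (twist U a◁c twistable)) ◅ ε

    pinned-resp-≈ : Rigid a c S → Unique x → TwistCong k x y → Pinned x a c S → Pinned y a c S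
    pinned-resp-≈ rigid ux ε pinned = pinned
    pinned-resp-≈ rigid ux (s ◅ ss) pinned with step-view s
    ... | fwd t = pinned-resp-≈ rigid (unique-twist t ux) ss (pinned-twist t pinned)
    ... | bwd t = pinned-resp-≈ rigid (unique-untwist t ux) ss (pinned-untwist rigid ux t pinned)

    irreducible-pinned : IsPerm n m → Irreducible m → TwistCong k m z → DescentsPinned m z
    irreducible-pinned pm irr m≈z U c a T e a◁c =
      pinned-resp-≈ (irreducible-rigid irr e a◁c) (proj₁ pm) m≈z (pinned-self pm e a◁c)

    irreducible-least : IsPerm n m → Irreducible m → IsPerm n z → TwistCong k m z → Le m z
    irreducible-least pm irr pz m≈z = le-of-pinned pm (proj₁ pz) (irreducible-pinned pm irr m≈z)

    -- Untwisting twistable descents terminates (each step removes a coinversion) in an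
    -- irreducible permutation.
    irreducible-form : IsPerm n x → Σ (List F) λ m → TwistCong k x m × IsPerm n m × Irreducible m
    irreducible-form {x = x} px = descend x (<-wellFounded (pairs _◁?_ x)) px
      where
      descend : ∀ x → Acc _<_ (pairs _◁?_ x) → IsPerm n x →
        Σ (List F) λ m → TwistCong k x m × IsPerm n m × Irreducible m
      descend x (acc smaller) px with adjacent? twistableDescent? x
      ... | no irr = x , ε , px , irr
      ... | yes (U , c , a , T , refl , a◁c , twistable)
        with descend (U ++ a ∷ c ∷ T) (smaller (pairs-swap _◁?_ U a◁c (asym a◁c))) (perm-resp-↭ (swap↭ U) px)
      ...   | m , x′≈m , pm , irr = m , untwist U a◁c twistable ◅◅ x′≈m , pm , irr

    Least : List F → List F → Set
    Least m x = IsPerm n m × TwistCong k m x × (∀ z → IsPerm n z → TwistCong k z x → Le m z)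

    -- Every class has a least element: any irreducible form of its members.
    least-exists : IsPerm n x → Σ (List F) λ m → Least m x
    least-exists px with irreducible-form px
    ... | m , x≈m , pm , irr =
      m , pm , ≈-sym x≈m , λ z pz z≈x → irreducible-least pm irr pz (≈-sym x≈m ◅◅ ≈-sym z≈x)

    -- A least element is irreducible: untwisting a descent c a would give a smaller word.
    least-irreducible : Least m x → Irreducible m
    least-irreducible {x = x} (pm , m≈x , least) (U , c , a , T , refl , a◁c , twistable) =
      before-asym (proj₁ p-down) (least down p-down down≈x c a (a◁c , before-++ʳ U (first (here refl))))
                                 (before-++ʳ U (first (here refl)))
      where
      down = U ++ a ∷ c ∷ T
      p-down : IsPerm n down
      p-down = perm-resp-↭ (swap↭ U) pm
      down≈x : TwistCong k down x
      down≈x = ≈-sym (untwist U a◁c twistable) ◅◅ m≈x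

    -- Class minima are monotone: the descents of the minimum of x are pinned in x,
    -- hence in every y ≥ x, hence in the minimum of y.
    least-monotone : IsPerm n x → IsPerm n y → Le x y → Least m x → Least m′ y → Le m m′
    least-monotone px py x≤y least-m@(pm , m≈x , _) (pm′ , m′≈y , _) =
      le-of-pinned pm (proj₁ pm′) λ U c a T e a◁c →
        let rigid = irreducible-rigid (least-irreducible least-m) e a◁c
            pinned-x = pinned-resp-≈ rigid (proj₁ pm) m≈x (pinned-self pm e a◁c)
        in pinned-resp-≈ rigid (proj₁ py) (≈-sym m′≈y) (pinned-mono x≤y pinned-x)

    -- Every permutation z between two class members m ≤ z ≤ M belongs to their class:
    -- untwist a descent of z absent from m; it cannot be rigid, since then it would be
    -- pinned in z, hence in M, hence in m.
    interval : IsPerm n m → IsPerm n M → TwistCong k M m → IsPerm n z → Le m z → Le z M → TwistCong k z m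
    interval {m = m} {M = M} {z = z} pm pM M≈m pz = descend z (<-wellFounded (pairs _◁?_ z)) pz
      where
      newDescent? : ∀ c a T → Dec (NewDescent m c a T)
      newDescent? c a T with a ◁? c
      ... | no ¬a◁c = no (¬a◁c ∘ proj₁)
      ... | yes a◁c with before? (proj₁ pm) (◁⇒≢ a◁c) (perm-complete pm a) (perm-complete pm c)
      ...   | yes b = yes (a◁c , b)
      ...   | no ¬b = no (¬b ∘ proj₂)
      descend : ∀ z → Acc _<_ (pairs _◁?_ z) → IsPerm n z → Le m z → Le z M → TwistCong k z m
      descend z (acc smaller) pz m≤z z≤M with adjacent? newDescent? z
      ... | no none = subst (λ w → TwistCong k w m) (sym (le-antisym pz pm z≤m m≤z)) ε
        where
        z≤m : Le z m
        z≤m j i (i◁j , bz) with before-total (◁⇒≢ i◁j) (perm-complete pm i) (perm-complete pm j)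
        ... | inj₁ bm = ⊥-elim (none (new-descent pm pz m≤z i◁j bz bm))
        ... | inj₂ bm = bm
      ... | yes (U , c , a , T , refl , a◁c , bm) with k ≤? #inside a c T
      ...   | yes twistable =
        untwist U a◁c twistable ◅◅ descend (U ++ a ∷ c ∷ T) (smaller (pairs-swap _◁?_ U a◁c (asym a◁c)))
          (perm-resp-↭ (swap↭ U) pz)
          (forced-swap U (λ (_ , bm′) → before-asym (proj₁ pm) bm bm′) m≤z)
          (le-trans (le-twist (twist U a◁c twistable)) z≤M)
      ...   | no ¬twistable = ⊥-elim (before-asym (proj₁ pm) bm pinned-m)
        where
        rigid = ≰⇒> ¬twistable
        pinned-m : Before m c a
        pinned-m = pinned-resp-≈ rigid (proj₁ pM) M≈m (pinned-mono z≤M (pinned-self pz refl a◁c))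
               c a (inj₁ refl , inj₁ refl , a◁c)

-- The statement's twist steps, in the orientations < and >.

between⇒count : {n j : ℕ} {a c : Fin n} {R : List (Fin n)} {P : Pred (Fin n) 0ℓ} (P? : Decidable P) →
  (∀ {e} → a <ᶠ e → e <ᶠ c → P e) → Between a c j R → j ≤ count P? R
between⇒count P? covers (done _) = z≤n
between⇒count P? covers (skip x xs b) with P? x
... | yes _ = m≤n⇒m≤1+n (between⇒count P? covers b)
... | no _ = between⇒count P? covers b
between⇒count P? covers (take x xs a<x x<c b) rewrite filter-accept P? {x} {xs} (covers a<x x<c) =
  s≤s (between⇒count P? covers b)

count⇒between : {n : ℕ} {a c : Fin n} {P : Pred (Fin n) 0ℓ} (P? : Decidable P) →
  (∀ {e} → P e → a <ᶠ e × e <ᶠ c) → ∀ j R → j ≤ count P? R → Between a c j R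
count⇒between P? sound zero R _ = done R
count⇒between P? sound (suc j) (x ∷ R) enough with P? x
... | yes px =
  take x R (proj₁ (sound px)) (proj₂ (sound px)) (count⇒between P? sound j R (≤-pred enough))
... | no _ = skip x R (count⇒between P? sound (suc j) R enough)

module TwistCongruence (k n : ℕ) where

  module Up = Oriented k (<-isStrictTotalOrder {n})
  module Down = Oriented k (Flip.isStrictTotalOrder (<-isStrictTotalOrder {n}))

  view-up : {x y : List (Fin n)} → TwistStep k x y → SymClosure Up.Twist x y
  view-up (U , a , c , R , a<c , between , refl , refl) =
    fwd (Up.twist U a<c (between⇒count (Up.inside? a c) _,_ between))

  realise-up : {x y : List (Fin n)} → Up.Twist x y → SymClosure (TwistStep k) x y
  realise-up (Up.twist U {a} {c} {T} a<c twistable) =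
    fwd (U , a , c , T , a<c , count⇒between (Up.inside? a c) id k T twistable , refl , refl)

  view-down : {x y : List (Fin n)} → TwistStep k x y → SymClosure Down.Twist x y
  view-down (U , a , c , R , a<c , between , refl , refl) =
    bwd (Down.twist U a<c (between⇒count (Down.inside? c a) (λ a<e e<c → e<c , a<e) between))

  realise-down : {x y : List (Fin n)} → Down.Twist x y → SymClosure (TwistStep k) x y
  realise-down (Down.twist U {a} {c} {T} c<a twistable) =
    bwd (U , c , a , T , c<a , count⇒between (Down.inside? a c) (λ (e<a , c<e) → c<e , e<a) k T twistable ,
         refl , refl)

  module ↑ = Up.Classes view-up realise-up
  module ↓ = Down.Classes view-down realise-down

  weak⇒up : {x y : List (Fin n)} → WeakLe x y → Up.Le x y
  weak⇒up x≤y j i (i<j , b) = coinv⇒before (x≤y i j (before⇒coinv i<j b))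

  up⇒weak : {x y : List (Fin n)} → Up.Le x y → WeakLe x y
  up⇒weak x≤y i j coinv@(i<j , _) = before⇒coinv i<j (x≤y j i (i<j , coinv⇒before coinv))

  weak⇒down : {x y : List (Fin n)} → IsPerm n x → IsPerm n y → WeakLe x y → Down.Le y x
  weak⇒down px py x≤y j i (j<i , by) with before-total (Up.◁⇒≢ j<i) (perm-complete px j) (perm-complete px i)
  ... | inj₁ bx = bx
  ... | inj₂ bx = ⊥-elim (before-asym (proj₁ py) by (coinv⇒before (x≤y j i (before⇒coinv j<i bx))))

  down⇒weak : {x y : List (Fin n)} → IsPerm n x → IsPerm n y → Down.Le y x → WeakLe x y
  down⇒weak px py y≥x i j coinv@(i<j , _) with before-total (Down.◁⇒≢ i<j) (perm-complete py j) (perm-complete py i)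
  ... | inj₁ by = before⇒coinv i<j by
  ... | inj₂ by = ⊥-elim (before-asym (proj₁ px) (coinv⇒before coinv) (y≥x i j (i<j , by)))

  min⇒least : {m x : List (Fin n)} → IsClassMin n (TwistCong k) m x → ↑.Least m x
  min⇒least (pm , m≈x , least) = pm , m≈x , λ z pz z≈x → weak⇒up (least z pz z≈x)

  least⇒min : {m x : List (Fin n)} → ↑.Least m x → IsClassMin n (TwistCong k) m x
  least⇒min (pm , m≈x , least) = pm , m≈x , λ z pz z≈x → up⇒weak (least z pz z≈x)

  max⇒least : {M x : List (Fin n)} → IsClassMax n (TwistCong k) M x → ↓.Least M x
  max⇒least (pM , M≈x , greatest) = pM , M≈x , λ z pz z≈x → weak⇒down pz pM (greatest z pz z≈x)

  least⇒max : {M x : List (Fin n)} → ↓.Least M x → IsClassMax n (TwistCong k) M x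
  least⇒max (pM , M≈x , least) = pM , M≈x , λ z pz z≈x → down⇒weak pz pM (least z pz z≈x)

  classes-are-intervals : ∀ x → IsPerm n x →
    Σ (List (Fin n)) λ m → Σ (List (Fin n)) λ M →
      IsClassMin n (TwistCong k) m x × IsClassMax n (TwistCong k) M x ×
      (∀ z → IsPerm n z → (TwistCong k z x → WeakLe m z × WeakLe z M)
                         × (WeakLe m z × WeakLe z M → TwistCong k z x))
  classes-are-intervals x px with ↑.least-exists px | ↓.least-exists px
  ... | m , least-m@(pm , m≈x , m-least) | M , least-M@(pM , M≈x , M-greatest) =
    m , M , least⇒min least-m , least⇒max least-M , λ z pz →
      (λ z≈x → up⇒weak (m-least z pz z≈x) , down⇒weak pz pM (M-greatest z pz z≈x)) ,
      λ (m≤z , z≤M) → ↑.interval pm pM (M≈x ◅◅ ↑.≈-sym m≈x) pz (weak⇒up m≤z) (weak⇒up z≤M) ◅◅ m≈x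

  min-monotone : ∀ x y mx my → IsPerm n x → IsPerm n y → WeakLe x y →
    IsClassMin n (TwistCong k) mx x → IsClassMin n (TwistCong k) my y → WeakLe mx my
  min-monotone x y mx my px py x≤y min-x min-y =
    up⇒weak (↑.least-monotone px py (weak⇒up x≤y) (min⇒least min-x) (min⇒least min-y))

  max-monotone : ∀ x y Mx My → IsPerm n x → IsPerm n y → WeakLe x y →
    IsClassMax n (TwistCong k) Mx x → IsClassMax n (TwistCong k) My y → WeakLe Mx My
  max-monotone x y Mx My px py x≤y max-x@(pMx , _) max-y@(pMy , _) =
    down⇒weak pMx pMy (↓.least-monotone py px (weak⇒down px py x≤y) (max⇒least max-y) (max⇒least max-x))

theorem37 : (k n : ℕ) → IsLatticeCongruence n (TwistCong k {n})
theorem37 k n = classes-are-intervals , min-monotone , max-monotone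
  where open TwistCongruence k n
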